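{- Let $\mathbf A$ be a 0-commutative orthogroupoid and let $\mathrm{Ce}(A)$ be its set of central elements. Then $\mathrm{Ce}(A)$ is closed under $+$, $\cdot$ and $'$, contains $0$ and $1$, and $\langle\mathrm{Ce}(A),+,\cdot,',0,1\rangle$ is a Boolean algebra (with join $+$, meet $\cdot$, complement $'$).
   Context: An orthogroupoid is an algebra $\langle A,+,',1\rangle$ of type $(2,1,0)$, with $0:=1'$, satisfying: (a) $x''\approx x$; (b) $0+x\approx x$ and $x+1\approx 1$; (c) $x+x'\approx 1$; (d) for all $x,z$: if $x+z=z$ and $x'+z=z$ then $z=1$; (e) $(((z+y)'+(z+x))'+(z+y)')+z'\approx z'$; (f) $x+(x+y)\approx x+y$ and $y+(x+y)\approx x+y$. It is 0-commutative if it satisfies $x+0\approx 0+x$. Define $x\cdot y:=(x'+y')'$. An element $e\in A$ is central if the principal congruences $\theta(e,0)$ and $\theta(e,1)$ form a pair of factor congruences of $\mathbf A$, i.e. $\theta(e,0)\cap\theta(e,1)$ is the identity relation and $\theta(e,0)\circ\theta(e,1)=A\times A$. -}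

module Defs where

open import Level using (0ℓ)
open import Data.Product using (Σ; ∃; _×_; _,_; proj₁)
open import Relation.Binary.PropositionalEquality using (_≡_)
open import Relation.Binary.Core using (Rel)
open import Algebra.Lattice.Structures using (IsBooleanAlgebra)

record Orthogroupoid : Set₁ where
  infixl 6 _⊕_
  infix 8 _′
  field
    Carrier : Set
    _⊕_     : Carrier → Carrier → Carrier
    _′      : Carrier → Carrier
    𝟙       : Carrier

  𝟘 : Carrier
  𝟘 = 𝟙 ′

  field
    ax-a  : ∀ x → x ′ ′ ≡ x
    ax-b₁ : ∀ x → 𝟘 ⊕ x ≡ x
    ax-b₂ : ∀ x → x ⊕ 𝟙 ≡ 𝟙
    ax-c  : ∀ x → x ⊕ x ′ ≡ 𝟙
    ax-d  : ∀ x z → x ⊕ z ≡ z → x ′ ⊕ z ≡ z → z ≡ 𝟙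
    ax-e  : ∀ x y z → ((((z ⊕ y) ′ ⊕ (z ⊕ x)) ′) ⊕ (z ⊕ y) ′) ⊕ z ′ ≡ z ′
    ax-f₁ : ∀ x y → x ⊕ (x ⊕ y) ≡ x ⊕ y
    ax-f₂ : ∀ x y → y ⊕ (x ⊕ y) ≡ x ⊕ y

  _·_ : Carrier → Carrier → Carrier
  x · y = (x ′ ⊕ y ′) ′

  ZeroCommutative : Set
  ZeroCommutative = ∀ x → x ⊕ 𝟘 ≡ 𝟘 ⊕ x

  -- Principal congruence θ(a,b): the least congruence of ⟨A,+,',1⟩
  -- containing (a,b), given inductively.
  data θ (a b : Carrier) : Carrier → Carrier → Set where
    θ-gen   : θ a b a b
    θ-refl  : ∀ {x} → θ a b x x
    θ-sym   : ∀ {x y} → θ a b x y → θ a b y x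
    θ-trans : ∀ {x y z} → θ a b x y → θ a b y z → θ a b x z
    θ-⊕     : ∀ {x y u v} → θ a b x y → θ a b u v → θ a b (x ⊕ u) (y ⊕ v)
    θ-′     : ∀ {x y} → θ a b x y → θ a b (x ′) (y ′)

  -- e is central iff θ(e,0), θ(e,1) are a pair of factor congruences
  Central : Carrier → Set
  Central e =
    (∀ x y → θ e 𝟘 x y → θ e 𝟙 x y → x ≡ y) ×
    (∀ x y → ∃ λ z → θ e 𝟘 x z × θ e 𝟙 z y)

  Ce : Set
  Ce = Σ Carrier Central

  _≈ᶜ_ : Rel Ce 0ℓ
  a ≈ᶜ b = proj₁ a ≡ proj₁ b

  record CeClosed : Set where
    field
      ⊕-closed : ∀ x y → Central x → Central y → Central (x ⊕ y)
      ·-closed : ∀ x y → Central x → Central y → Central (x · y)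
      ′-closed : ∀ x → Central x → Central (x ′)
      𝟘-central : Central 𝟘
      𝟙-central : Central 𝟙

    _⊕ᶜ_ : Ce → Ce → Ce
    (x , cx) ⊕ᶜ (y , cy) = x ⊕ y , ⊕-closed x y cx cy

    _·ᶜ_ : Ce → Ce → Ce
    (x , cx) ·ᶜ (y , cy) = x · y , ·-closed x y cx cy

    _′ᶜ : Ce → Ce
    (x , cx) ′ᶜ = x ′ , ′-closed x cx

    𝟘ᶜ : Ce
    𝟘ᶜ = 𝟘 , 𝟘-central

    𝟙ᶜ : Ce
    𝟙ᶜ = 𝟙 , 𝟙-central

    IsBA : Set
    IsBA = IsBooleanAlgebra _≈ᶜ_ _⊕ᶜ_ _·ᶜ_ _′ᶜ 𝟙ᶜ 𝟘ᶜ

-- An element g is central exactly when the term  choose g x y = g·x + g'·y  satisfies the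
-- identities of a decomposition operator (IsDecomposition): these say that the map
-- (x , y) ↦ choose g x y inverts A → A/θ(g,1) × A/θ(g,0). Modulo θ(e,0) and θ(e,1) a central
-- element e behaves like 0 and 1 respectively, and these two congruences separate points, so
-- anything that holds when e is replaced by 0 and by 1 holds for e. Hence e + f is central
-- (it is f modulo θ(e,0) and 1 modulo θ(e,1)), and likewise for e·f and e'; and the Boolean
-- algebra laws reduce to the unit and zero laws of + and ·, for which 0-commutativity
-- supplies the missing x + 0 = x and 1 + x = 1.
module Submission where

open import Defs
open import Data.Product using (Σ; _,_; proj₁)
open import Relation.Binary.PropositionalEquality

module _ (A : Orthogroupoid) where
  open Orthogroupoid A

  ·-zeroʳ : ∀ x → x · 𝟘 ≡ 𝟘
  ·-zeroʳ x = cong _′ (trans (cong (x ′ ⊕_) (ax-a 𝟙)) (ax-b₂ (x ′)))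

  ·-identityˡ : ∀ x → 𝟙 · x ≡ x
  ·-identityˡ x = trans (cong _′ (ax-b₁ (x ′))) (ax-a x)

  ⊕-complementˡ : ∀ x → x ′ ⊕ x ≡ 𝟙
  ⊕-complementˡ x = trans (cong (x ′ ⊕_) (sym (ax-a x))) (ax-c (x ′))

  ·-complementˡ : ∀ x → (x ′) · x ≡ 𝟘
  ·-complementˡ x = cong _′ (trans (cong (_⊕ x ′) (ax-a x)) (ax-c x))

  ·-complementʳ : ∀ x → x · (x ′) ≡ 𝟘
  ·-complementʳ x = cong _′ (trans (cong (x ′ ⊕_) (ax-a x)) (⊕-complementˡ x))

  module _ {a b : Carrier} where

    θ-via : ∀ {x x′ y y′} → θ a b x x′ → x′ ≡ y′ → θ a b y y′ → θ a b x y
    θ-via p refl q = θ-trans p (θ-sym q)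

    θ-· : ∀ {x y u v} → θ a b x y → θ a b u v → θ a b (x · u) (y · v)
    θ-· p q = θ-′ (θ-⊕ (θ-′ p) (θ-′ q))

  Compatible : (Carrier → Carrier) → Set
  Compatible f = ∀ {a b x y} → θ a b x y → θ a b (f x) (f y)

  identity-by-cases : ∀ {e} → Central e → (f g : Carrier → Carrier) → Compatible f → Compatible g →
                      f 𝟘 ≡ g 𝟘 → f 𝟙 ≡ g 𝟙 → f e ≡ g e
  identity-by-cases (separate , _) f g f-compat g-compat f𝟘≡g𝟘 f𝟙≡g𝟙 =
    separate _ _ (θ-via (f-compat θ-gen) f𝟘≡g𝟘 (g-compat θ-gen))
                 (θ-via (f-compat θ-gen) f𝟙≡g𝟙 (g-compat θ-gen))

  choose : Carrier → Carrier → Carrier → Carrier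
  choose g x y = (g · x) ⊕ ((g ′) · y)

  θ-choose : ∀ {a b g h x x′ y y′} → θ a b g h → θ a b x x′ → θ a b y y′ →
             θ a b (choose g x y) (choose h x′ y′)
  θ-choose G X Y = θ-⊕ (θ-· G X) (θ-· (θ-′ G) Y)

  record IsDecomposition (_∼_ : Carrier → Carrier → Set) (g : Carrier) : Set where
    field
      choose-idem    : ∀ x → choose g x x ∼ x
      choose-absorbˡ : ∀ x y z → choose g (choose g x y) z ∼ choose g x z
      choose-absorbʳ : ∀ x y z → choose g x (choose g y z) ∼ choose g x z
      choose-⊕       : ∀ x y u v → choose g (x ⊕ y) (u ⊕ v) ∼ (choose g x u ⊕ choose g y v)
      choose-′       : ∀ x y → choose g (x ′) (y ′) ∼ (choose g x y ′)
      choose-self-𝟘  : choose g g 𝟘 ∼ g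
      choose-self-𝟙  : choose g g 𝟙 ∼ 𝟙

  Decomposition : Carrier → Set
  Decomposition = IsDecomposition _≡_

  IsDecomposition-zip : ∀ {R S T : Carrier → Carrier → Set} {g} →
                        (∀ {u v} → R u v → S u v → T u v) →
                        IsDecomposition R g → IsDecomposition S g → IsDecomposition T g
  IsDecomposition-zip both dR dS = record
    { choose-idem    = λ x → both (R.choose-idem x) (S.choose-idem x)
    ; choose-absorbˡ = λ x y z → both (R.choose-absorbˡ x y z) (S.choose-absorbˡ x y z)
    ; choose-absorbʳ = λ x y z → both (R.choose-absorbʳ x y z) (S.choose-absorbʳ x y z)
    ; choose-⊕       = λ x y u v → both (R.choose-⊕ x y u v) (S.choose-⊕ x y u v)
    ; choose-′       = λ x y → both (R.choose-′ x y) (S.choose-′ x y)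
    ; choose-self-𝟘  = both R.choose-self-𝟘 S.choose-self-𝟘
    ; choose-self-𝟙  = both R.choose-self-𝟙 S.choose-self-𝟙
    }
    where
    module R = IsDecomposition dR
    module S = IsDecomposition dS

  IsDecomposition-θ : ∀ {a b g h} → θ a b g h → Decomposition h → IsDecomposition (θ a b) g
  IsDecomposition-θ G dh = record
    { choose-idem    = λ x → θ-via (θ-choose G θ-refl θ-refl) (choose-idem x) θ-refl
    ; choose-absorbˡ = λ x y z → θ-via (θ-choose G (θ-choose G θ-refl θ-refl) θ-refl)
                                       (choose-absorbˡ x y z) (θ-choose G θ-refl θ-refl)
    ; choose-absorbʳ = λ x y z → θ-via (θ-choose G θ-refl (θ-choose G θ-refl θ-refl))
                                       (choose-absorbʳ x y z) (θ-choose G θ-refl θ-refl)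
    ; choose-⊕       = λ x y u v → θ-via (θ-choose G θ-refl θ-refl) (choose-⊕ x y u v)
                                         (θ-⊕ (θ-choose G θ-refl θ-refl) (θ-choose G θ-refl θ-refl))
    ; choose-′       = λ x y → θ-via (θ-choose G θ-refl θ-refl) (choose-′ x y)
                                     (θ-′ (θ-choose G θ-refl θ-refl))
    ; choose-self-𝟘  = θ-via (θ-choose G G θ-refl) choose-self-𝟘 G
    ; choose-self-𝟙  = θ-via (θ-choose G G θ-refl) choose-self-𝟙 θ-refl
    }
    where open IsDecomposition dh

  module _ {g : Carrier} (dg : Decomposition g) where
    open IsDecomposition dg

    choose-θ𝟘 : ∀ {x y} → θ g 𝟘 x y → choose g x y ≡ x
    choose-θ𝟘 θ-gen                         = choose-self-𝟘
    choose-θ𝟘 θ-refl                        = choose-idem _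
    choose-θ𝟘 {x} {y} (θ-sym p)             = begin
      choose g x y              ≡⟨ cong (choose g x) (sym (choose-θ𝟘 p)) ⟩
      choose g x (choose g y x) ≡⟨ choose-absorbʳ x y x ⟩
      choose g x x              ≡⟨ choose-idem x ⟩
      x                         ∎
      where open ≡-Reasoning
    choose-θ𝟘 {x} {z} (θ-trans {y = y} p q) = begin
      choose g x z              ≡⟨ choose-absorbʳ x y z ⟨
      choose g x (choose g y z) ≡⟨ cong (choose g x) (choose-θ𝟘 q) ⟩
      choose g x y              ≡⟨ choose-θ𝟘 p ⟩
      x                         ∎
      where open ≡-Reasoning
    choose-θ𝟘 (θ-⊕ p q)                     = trans (choose-⊕ _ _ _ _) (cong₂ _⊕_ (choose-θ𝟘 p) (choose-θ𝟘 q))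
    choose-θ𝟘 (θ-′ p)                       = trans (choose-′ _ _) (cong _′ (choose-θ𝟘 p))

    choose-θ𝟙 : ∀ {x y} → θ g 𝟙 x y → choose g x y ≡ y
    choose-θ𝟙 θ-gen                         = choose-self-𝟙
    choose-θ𝟙 θ-refl                        = choose-idem _
    choose-θ𝟙 {y} {x} (θ-sym p)             = begin
      choose g y x              ≡⟨ cong (λ w → choose g w x) (sym (choose-θ𝟙 p)) ⟩
      choose g (choose g x y) x ≡⟨ choose-absorbˡ x y x ⟩
      choose g x x              ≡⟨ choose-idem x ⟩
      x                         ∎
      where open ≡-Reasoning
    choose-θ𝟙 {x} {z} (θ-trans {y = y} p q) = begin
      choose g x z              ≡⟨ choose-absorbˡ x y z ⟨
      choose g (choose g x y) z ≡⟨ cong (λ w → choose g w z) (choose-θ𝟙 p) ⟩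
      choose g y z              ≡⟨ choose-θ𝟙 q ⟩
      z                         ∎
      where open ≡-Reasoning
    choose-θ𝟙 (θ-⊕ p q)                     = trans (choose-⊕ _ _ _ _) (cong₂ _⊕_ (choose-θ𝟙 p) (choose-θ𝟙 q))
    choose-θ𝟙 (θ-′ p)                       = trans (choose-′ _ _) (cong _′ (choose-θ𝟙 p))

  module _ (zero-commutative : ZeroCommutative) where

    ⊕-identityʳ : ∀ x → x ⊕ 𝟘 ≡ x
    ⊕-identityʳ x = trans (zero-commutative x) (ax-b₁ x)

    ⊕-zeroˡ : ∀ x → 𝟙 ⊕ x ≡ 𝟙
    ⊕-zeroˡ x = begin
      𝟙 ⊕ x       ≡⟨ ax-a (𝟙 ⊕ x) ⟨
      (𝟙 ⊕ x) ′ ′ ≡⟨ cong _′ s′≡𝟘 ⟩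
      𝟘 ′         ≡⟨ ax-a 𝟙 ⟩
      𝟙           ∎
      where
      open ≡-Reasoning
      s = 𝟙 ⊕ x
      -- axiom (e) with z = 1 and x = y, once 0 + s' has been rewritten as ((s' + s)' + s') + 1'
      s′≡𝟘 : s ′ ≡ 𝟘
      s′≡𝟘 = begin
        s ′                                ≡⟨ ax-b₁ (s ′) ⟨
        𝟘 ⊕ s ′                            ≡⟨ ⊕-identityʳ (𝟘 ⊕ s ′) ⟨
        (𝟘 ⊕ s ′) ⊕ 𝟘                      ≡⟨ cong (λ w → (w ′ ⊕ s ′) ⊕ 𝟘) (⊕-complementˡ s) ⟨
        (((s ′ ⊕ s) ′) ⊕ s ′) ⊕ 𝟙 ′        ≡⟨ ax-e x x 𝟙 ⟩
        𝟘                                  ∎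

    ·-zeroˡ : ∀ x → 𝟘 · x ≡ 𝟘
    ·-zeroˡ x = cong _′ (trans (cong (_⊕ x ′) (ax-a 𝟙)) (⊕-zeroˡ (x ′)))

    ·-identityʳ : ∀ x → x · 𝟙 ≡ x
    ·-identityʳ x = trans (cong _′ (⊕-identityʳ (x ′))) (ax-a x)

    choose-𝟙 : ∀ x y → choose 𝟙 x y ≡ x
    choose-𝟙 x y = trans (cong₂ _⊕_ (·-identityˡ x) (·-zeroˡ y)) (⊕-identityʳ x)

    choose-𝟘 : ∀ x y → choose 𝟘 x y ≡ y
    choose-𝟘 x y = trans (cong₂ _⊕_ (·-zeroˡ x) (trans (cong (_· y) (ax-a 𝟙)) (·-identityˡ y))) (ax-b₁ y)

    decomposition-𝟙 : Decomposition 𝟙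
    decomposition-𝟙 = record
      { choose-idem    = λ x → choose-𝟙 x x
      ; choose-absorbˡ = λ x y z → trans (choose-𝟙 _ z) (trans (choose-𝟙 x y) (sym (choose-𝟙 x z)))
      ; choose-absorbʳ = λ x y z → trans (choose-𝟙 x _) (sym (choose-𝟙 x z))
      ; choose-⊕       = λ x y u v → trans (choose-𝟙 _ _) (sym (cong₂ _⊕_ (choose-𝟙 x u) (choose-𝟙 y v)))
      ; choose-′       = λ x y → trans (choose-𝟙 _ _) (cong _′ (sym (choose-𝟙 x y)))
      ; choose-self-𝟘  = choose-𝟙 𝟙 𝟘
      ; choose-self-𝟙  = choose-𝟙 𝟙 𝟙
      }

    decomposition-𝟘 : Decomposition 𝟘
    decomposition-𝟘 = record
      { choose-idem    = λ x → choose-𝟘 x x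
      ; choose-absorbˡ = λ x y z → trans (choose-𝟘 _ z) (sym (choose-𝟘 x z))
      ; choose-absorbʳ = λ x y z → trans (choose-𝟘 x _) (trans (choose-𝟘 y z) (sym (choose-𝟘 x z)))
      ; choose-⊕       = λ x y u v → trans (choose-𝟘 _ _) (sym (cong₂ _⊕_ (choose-𝟘 x u) (choose-𝟘 y v)))
      ; choose-′       = λ x y → trans (choose-𝟘 _ _) (cong _′ (sym (choose-𝟘 x y)))
      ; choose-self-𝟘  = choose-𝟘 𝟘 𝟘
      ; choose-self-𝟙  = choose-𝟘 𝟘 𝟙
      }

    central⇒decomposition : ∀ {e} → Central e → Decomposition e
    central⇒decomposition (separate , _) =
      IsDecomposition-zip (separate _ _) (IsDecomposition-θ θ-gen decomposition-𝟘)
                                         (IsDecomposition-θ θ-gen decomposition-𝟙)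

    decomposition⇒central : ∀ {g} → Decomposition g → Central g
    decomposition⇒central dg =
      (λ _ _ p q → trans (sym (choose-θ𝟘 dg p)) (choose-θ𝟙 dg q)) ,
      (λ x y → choose _ y x ,
               θ-via θ-refl (sym (choose-𝟘 y x)) (θ-choose θ-gen θ-refl θ-refl) ,
               θ-via (θ-choose θ-gen θ-refl θ-refl) (choose-𝟙 y x) θ-refl)

    central-by-cases : ∀ {e} → Central e → (f : Carrier → Carrier) → Compatible f →
                       Central (f 𝟘) → Central (f 𝟙) → Central (f e)
    central-by-cases (separate , _) f f-compat c𝟘 c𝟙 = decomposition⇒central
      (IsDecomposition-zip (separate _ _)
        (IsDecomposition-θ (f-compat θ-gen) (central⇒decomposition c𝟘))
        (IsDecomposition-θ (f-compat θ-gen) (central⇒decomposition c𝟙)))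

    𝟘-central : Central 𝟘
    𝟘-central = decomposition⇒central decomposition-𝟘

    𝟙-central : Central 𝟙
    𝟙-central = decomposition⇒central decomposition-𝟙

    ceClosed : CeClosed
    ceClosed = record
      { ⊕-closed  = λ _ f ce cf → central-by-cases ce (_⊕ f) (λ p → θ-⊕ p θ-refl)
                      (subst Central (sym (ax-b₁ f)) cf) (subst Central (sym (⊕-zeroˡ f)) 𝟙-central)
      ; ·-closed  = λ _ f ce cf → central-by-cases ce (_· f) (λ p → θ-· p θ-refl)
                      (subst Central (sym (·-zeroˡ f)) 𝟘-central) (subst Central (sym (·-identityˡ f)) cf)
      ; ′-closed  = λ _ ce → central-by-cases ce _′ θ-′ (subst Central (sym (ax-a 𝟙)) 𝟙-central) 𝟘-central
      ; 𝟘-central = 𝟘-central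
      ; 𝟙-central = 𝟙-central
      }

    module _ {e : Carrier} (ce : Central e) where

      ⊕-comm-central : ∀ y → e ⊕ y ≡ y ⊕ e
      ⊕-comm-central y = identity-by-cases ce (_⊕ y) (y ⊕_) (λ p → θ-⊕ p θ-refl) (θ-⊕ θ-refl)
        (trans (ax-b₁ y) (sym (⊕-identityʳ y)))
        (trans (⊕-zeroˡ y) (sym (ax-b₂ y)))

      ⊕-assoc-central : ∀ y z → (e ⊕ y) ⊕ z ≡ e ⊕ (y ⊕ z)
      ⊕-assoc-central y z = identity-by-cases ce (λ c → (c ⊕ y) ⊕ z) (_⊕ (y ⊕ z))
        (λ p → θ-⊕ (θ-⊕ p θ-refl) θ-refl) (λ p → θ-⊕ p θ-refl)
        (trans (cong (_⊕ z) (ax-b₁ y)) (sym (ax-b₁ (y ⊕ z))))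
        (trans (cong (_⊕ z) (⊕-zeroˡ y)) (trans (⊕-zeroˡ z) (sym (⊕-zeroˡ (y ⊕ z)))))

      ·-comm-central : ∀ y → e · y ≡ y · e
      ·-comm-central y = identity-by-cases ce (_· y) (y ·_) (λ p → θ-· p θ-refl) (θ-· θ-refl)
        (trans (·-zeroˡ y) (sym (·-zeroʳ y)))
        (trans (·-identityˡ y) (sym (·-identityʳ y)))

      ·-assoc-central : ∀ y z → (e · y) · z ≡ e · (y · z)
      ·-assoc-central y z = identity-by-cases ce (λ c → (c · y) · z) (_· (y · z))
        (λ p → θ-· (θ-· p θ-refl) θ-refl) (λ p → θ-· p θ-refl)
        (trans (cong (_· z) (·-zeroˡ y)) (trans (·-zeroˡ z) (sym (·-zeroˡ (y · z)))))
        (trans (cong (_· z) (·-identityˡ y)) (sym (·-identityˡ (y · z))))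

      ⊕-absorbs-·-central : ∀ y → e ⊕ (e · y) ≡ e
      ⊕-absorbs-·-central y = identity-by-cases ce (λ c → c ⊕ (c · y)) (λ c → c)
        (λ p → θ-⊕ p (θ-· p θ-refl)) (λ p → p)
        (trans (ax-b₁ (𝟘 · y)) (·-zeroˡ y))
        (⊕-zeroˡ (𝟙 · y))

      ·-absorbs-⊕-central : ∀ y → e · (e ⊕ y) ≡ e
      ·-absorbs-⊕-central y = identity-by-cases ce (λ c → c · (c ⊕ y)) (λ c → c)
        (λ p → θ-· p (θ-⊕ p θ-refl)) (λ p → p)
        (·-zeroˡ (𝟘 ⊕ y))
        (trans (·-identityˡ (𝟙 ⊕ y)) (⊕-zeroˡ y))

      ⊕-distribˡ-·-central : ∀ y z → e ⊕ (y · z) ≡ (e ⊕ y) · (e ⊕ z)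
      ⊕-distribˡ-·-central y z = identity-by-cases ce (_⊕ (y · z)) (λ c → (c ⊕ y) · (c ⊕ z))
        (λ p → θ-⊕ p θ-refl) (λ p → θ-· (θ-⊕ p θ-refl) (θ-⊕ p θ-refl))
        (trans (ax-b₁ (y · z)) (sym (cong₂ _·_ (ax-b₁ y) (ax-b₁ z))))
        (trans (⊕-zeroˡ (y · z)) (sym (trans (cong₂ _·_ (⊕-zeroˡ y) (⊕-zeroˡ z)) (·-identityˡ 𝟙))))

      ⊕-distribʳ-·-central : ∀ y z → (y · z) ⊕ e ≡ (y ⊕ e) · (z ⊕ e)
      ⊕-distribʳ-·-central y z = identity-by-cases ce ((y · z) ⊕_) (λ c → (y ⊕ c) · (z ⊕ c))
        (θ-⊕ θ-refl) (λ p → θ-· (θ-⊕ θ-refl p) (θ-⊕ θ-refl p))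
        (trans (⊕-identityʳ (y · z)) (sym (cong₂ _·_ (⊕-identityʳ y) (⊕-identityʳ z))))
        (trans (ax-b₂ (y · z)) (sym (trans (cong₂ _·_ (ax-b₂ y) (ax-b₂ z)) (·-identityˡ 𝟙))))

      ·-distribˡ-⊕-central : ∀ y z → e · (y ⊕ z) ≡ (e · y) ⊕ (e · z)
      ·-distribˡ-⊕-central y z = identity-by-cases ce (_· (y ⊕ z)) (λ c → (c · y) ⊕ (c · z))
        (λ p → θ-· p θ-refl) (λ p → θ-⊕ (θ-· p θ-refl) (θ-· p θ-refl))
        (trans (·-zeroˡ (y ⊕ z)) (sym (trans (cong₂ _⊕_ (·-zeroˡ y) (·-zeroˡ z)) (ax-b₁ 𝟘))))
        (trans (·-identityˡ (y ⊕ z)) (sym (cong₂ _⊕_ (·-identityˡ y) (·-identityˡ z))))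

      ·-distribʳ-⊕-central : ∀ y z → (y ⊕ z) · e ≡ (y · e) ⊕ (z · e)
      ·-distribʳ-⊕-central y z = identity-by-cases ce ((y ⊕ z) ·_) (λ c → (y · c) ⊕ (z · c))
        (θ-· θ-refl) (λ p → θ-⊕ (θ-· θ-refl p) (θ-· θ-refl p))
        (trans (·-zeroʳ (y ⊕ z)) (sym (trans (cong₂ _⊕_ (·-zeroʳ y) (·-zeroʳ z)) (ax-b₁ 𝟘))))
        (trans (·-identityʳ (y ⊕ z)) (sym (cong₂ _⊕_ (·-identityʳ y) (·-identityʳ z))))

    open CeClosed ceClosed

    ceIsBooleanAlgebra : IsBA
    ceIsBooleanAlgebra = record
      { isDistributiveLattice = record
        { isLattice = record
          { isEquivalence = record { refl = refl ; sym = sym ; trans = trans }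
          ; ∨-comm        = λ (_ , cx) (y , _) → ⊕-comm-central cx y
          ; ∨-assoc       = λ (_ , cx) (y , _) (z , _) → ⊕-assoc-central cx y z
          ; ∨-cong        = cong₂ _⊕_
          ; ∧-comm        = λ (_ , cx) (y , _) → ·-comm-central cx y
          ; ∧-assoc       = λ (_ , cx) (y , _) (z , _) → ·-assoc-central cx y z
          ; ∧-cong        = cong₂ _·_
          ; absorptive    = (λ (_ , cx) (y , _) → ⊕-absorbs-·-central cx y)
                          , (λ (_ , cx) (y , _) → ·-absorbs-⊕-central cx y)
          }
        ; ∨-distrib-∧ = (λ (_ , cx) (y , _) (z , _) → ⊕-distribˡ-·-central cx y z)
                      , (λ (_ , cx) (y , _) (z , _) → ⊕-distribʳ-·-central cx y z)
        ; ∧-distrib-∨ = (λ (_ , cx) (y , _) (z , _) → ·-distribˡ-⊕-central cx y z)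
                      , (λ (_ , cx) (y , _) (z , _) → ·-distribʳ-⊕-central cx y z)
        }
      ; ∨-complement = (λ (x , _) → ⊕-complementˡ x) , (λ (x , _) → ax-c x)
      ; ∧-complement = (λ (x , _) → ·-complementˡ x) , (λ (x , _) → ·-complementʳ x)
      ; ¬-cong       = cong _′
      }

proposition3p6 : (A : Orthogroupoid) → Orthogroupoid.ZeroCommutative A →
    Σ (Orthogroupoid.CeClosed A) (λ cl → Orthogroupoid.CeClosed.IsBA {A} cl)
proposition3p6 A zc = ceClosed A zc , ceIsBooleanAlgebra A zc
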